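{- For all integers $n\ge1$ and $k\ge1$, the residue of $\mathfrak B_{2n}^{(-k)}$ modulo $5$ depends only on $n \bmod 2$ and $k\bmod 4$, as follows: if $n$ is even, $\mathfrak B_{2n}^{(-k)}\equiv 3,4,2,1\pmod 5$ according as $k\equiv 0,1,2,3\pmod 4$; if $n$ is odd, $\mathfrak B_{2n}^{(-k)}\equiv 2,1,3,4\pmod 5$ according as $k\equiv 0,1,2,3\pmod 4$.
   Context: For an integer $k$, the poly-Bernoulli numbers with level $2$, $\mathfrak B_n^{(k)}$, are defined by the power series identity $$\sum_{n=0}^\infty\mathfrak B_n^{(k)}\frac{x^n}{n!}=\frac{{\rm Li}_{2,k}\bigl(2\sin(x/2)\bigr)}{2\sin(x/2)}=\sum_{m=0}^\infty\frac{\bigl(2\sin(x/2)\bigr)^{2m}}{(2m+1)^k},$$ where ${\rm Li}_{2,k}(z)=\sum_{n=0}^\infty\frac{z^{2n+1}}{(2n+1)^k}$. For $k\le 0$ these numbers are integers. -}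

module Defs where

open import Data.Bool using (if_then_else_)
open import Data.Nat as ℕ using (ℕ; zero; suc; _%_; _/_; _!)
open import Data.Integer as ℤ using (ℤ; +_)
open import Data.Rational as ℚ using (ℚ; 0ℚ; 1ℚ; _+_; _*_; -_)
open import Relation.Nullary.Decidable using (does)

-- Formal power series over ℚ, represented by their coefficient sequences:
-- a series  Σ aₙ xⁿ  is the function  n ↦ aₙ.
FPS : Set
FPS = ℕ → ℚ

_^ℚ_ : ℚ → ℕ → ℚ
q ^ℚ zero  = 1ℚ
q ^ℚ suc n = q * (q ^ℚ n)

invFact : ℕ → ℚ
invFact zero    = 1ℚ
invFact (suc n) = (+ 1 ℚ./ suc n) * invFact n

sumUpTo : ℕ → (ℕ → ℚ) → ℚ
sumUpTo zero    f = f 0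
sumUpTo (suc n) f = sumUpTo n f + f (suc n)

_⊛_ : FPS → FPS → FPS
(f ⊛ g) n = sumUpTo n (λ i → f i * g (n ℕ.∸ i))

oneS : FPS
oneS zero    = 1ℚ
oneS (suc _) = 0ℚ

_^S_ : FPS → ℕ → FPS
f ^S zero  = oneS
f ^S suc m = f ⊛ (f ^S m)

-- 2 sin(x/2) = Σ_{j≥0} (-1)^j · 2 · (x/2)^{2j+1} / (2j+1)!
-- coefficient of xⁿ: 0 for n even; for n = 2j+1 it is 2·(-1)^j·(1/2)^n/n!.
twoSinHalf : FPS
twoSinHalf n =
  if does (n % 2 ℕ.≟ 1)
  then (+ 2 ℚ./ 1) * ((- 1ℚ) ^ℚ (n / 2)) * ((+ 1 ℚ./ 2) ^ℚ n) * invFact n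
  else 0ℚ

twoSinHalfSq : FPS
twoSinHalfSq = twoSinHalf ⊛ twoSinHalf

-- Poly-Bernoulli numbers with level 2 and negative index:
-- polyBernoulli2 n k = 𝔅ₙ^{(-k)}, i.e. n! · [xⁿ] Σ_{m≥0} (2m+1)^k (2 sin(x/2))^{2m}.
-- Since (2 sin(x/2))^{2m} has order 2m, only m ≤ n contribute to [xⁿ],
-- so the (exact) truncation of the sum over m at n is used.
polyBernoulli2 : ℕ → ℕ → ℚ
polyBernoulli2 n k =
  (+ (n !) ℚ./ 1) *
  sumUpTo n (λ m → (+ ((2 ℕ.* m ℕ.+ 1) ℕ.^ k) ℚ./ 1) * (twoSinHalfSq ^S m) n)

residue : ℕ → ℕ → ℕ
residue 0 0 = 3
residue 0 1 = 4
residue 0 2 = 2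
residue 0 3 = 1
residue 1 0 = 2
residue 1 1 = 1
residue 1 2 = 3
residue 1 3 = 4
residue _ _ = 0

{-# OPTIONS --safe #-}
module Submission where

-- Let S = (2 sin(x/2))² and C = 2 cos(x/2). Everything is derived from the formal
-- differential equations (2 sin(x/2))'' = −¼ · 2 sin(x/2) and C = 2 (2 sin(x/2))', with
-- the principle that a series is determined by its constant term and its derivative:
-- this gives C² = 4 − S, S' = 2 sin(x/2) · C, S'' = 2 − S and S'² = 4S − S², hence
--   (S^{m+1})'' = 2(m+1)(2m+1) S^m − (m+1)² S^{m+1}.
-- So n! [xⁿ] S^m is an integer sinCoeff m n satisfying a two-term recurrence, and
-- 𝔅ₙ^(−k) = Σₘ (2m+1)^k sinCoeff m n.  Modulo 5 only the term m = 1 survives for even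
-- n ≥ 2: sinCoeff 0 n = 0, the term m = 2 carries the factor 5^k, and for m ≥ 3 the
-- recurrence coefficient 2·3·5 (at m = 2) propagates divisibility by 5.  Finally
-- sinCoeff 1 (2n) = 2 (−1)^(n+1), and 3^k mod 5 has period 4.

open import Algebra.Bundles using (CommutativeMonoid)
open import Algebra.Structures using (IsCommutativeMonoid)
open import Data.Integer as ℤ using (ℤ; +_)
import Data.Integer.Properties as ℤ
open import Data.Integer.Tactic.RingSolver using (solve-∀)
open import Data.Nat as ℕ using (ℕ; zero; suc; _!)
import Data.Nat.Properties as ℕ
import Data.Nat.Tactic.RingSolver as NatSolver
open import Data.Product using (_,_)
open import Function using (_∘_; const)
open import Level using (0ℓ)
open import Relation.Binary.Bundles using (Setoid)
open import Relation.Binary.PropositionalEquality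
open import Relation.Nullary.Decidable using (dec⇒maybe)
import Tactic.RingSolver as RingSolver
open import Tactic.RingSolver.Core.AlmostCommutativeRing
  using (AlmostCommutativeRing; fromCommutativeRing)

open import Defs

-- ℤ as a subring of ℚ
module _ where
  open import Data.Rational as ℚ using (ℚ; 0ℚ; 1ℚ; _+_; _*_; -_; toℚᵘ)
  import Data.Rational.Properties as ℚ
  open import Data.Rational.Unnormalised as ℚᵘ using (mkℚᵘ; *≡*)
  import Data.Rational.Unnormalised.Properties as ℚᵘ

  -- The zero test lets the solver cancel numeric coefficients such as ½ − ½.
  ℚ-ring : AlmostCommutativeRing 0ℓ 0ℓ
  ℚ-ring = fromCommutativeRing ℚ.+-*-commutativeRing (λ x → dec⇒maybe (0ℚ ℚ.≟ x))

  fromℤ : ℤ → ℚ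
  fromℤ z = z ℚ./ 1

  fromℕ : ℕ → ℚ
  fromℕ n = fromℤ (+ n)

  toℚᵘ-fromℤ : ∀ z → toℚᵘ (fromℤ z) ℚᵘ.≃ mkℚᵘ z 0
  toℚᵘ-fromℤ z = ℚ.toℚᵘ-fromℚᵘ (mkℚᵘ z 0)

  fromℤ-homo-+ : ∀ a b → fromℤ (a ℤ.+ b) ≡ fromℤ a + fromℤ b
  fromℤ-homo-+ a b = ℚ.toℚᵘ-injective (begin
    toℚᵘ (fromℤ (a ℤ.+ b))               ≈⟨ toℚᵘ-fromℤ (a ℤ.+ b) ⟩
    mkℚᵘ (a ℤ.+ b) 0                     ≈⟨ *≡* (sym (clear-denominators a b)) ⟩
    mkℚᵘ a 0 ℚᵘ.+ mkℚᵘ b 0               ≈⟨ ℚᵘ.+-cong (toℚᵘ-fromℤ a) (toℚᵘ-fromℤ b) ⟨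
    toℚᵘ (fromℤ a) ℚᵘ.+ toℚᵘ (fromℤ b)   ≈⟨ ℚ.toℚᵘ-homo-+ (fromℤ a) (fromℤ b) ⟨
    toℚᵘ (fromℤ a + fromℤ b)             ∎)
    where
    open ℚᵘ.≃-Reasoning
    clear-denominators : ∀ a b → (a ℤ.* + 1 ℤ.+ b ℤ.* + 1) ℤ.* + 1 ≡ (a ℤ.+ b) ℤ.* (+ 1 ℤ.* + 1)
    clear-denominators = solve-∀

  fromℤ-homo-* : ∀ a b → fromℤ (a ℤ.* b) ≡ fromℤ a * fromℤ b
  fromℤ-homo-* a b = ℚ.toℚᵘ-injective (begin
    toℚᵘ (fromℤ (a ℤ.* b))               ≈⟨ toℚᵘ-fromℤ (a ℤ.* b) ⟩
    mkℚᵘ (a ℤ.* b) 0                     ≈⟨ *≡* (sym (clear-denominators a b)) ⟩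
    mkℚᵘ a 0 ℚᵘ.* mkℚᵘ b 0               ≈⟨ ℚᵘ.*-cong (toℚᵘ-fromℤ a) (toℚᵘ-fromℤ b) ⟨
    toℚᵘ (fromℤ a) ℚᵘ.* toℚᵘ (fromℤ b)   ≈⟨ ℚ.toℚᵘ-homo-* (fromℤ a) (fromℤ b) ⟨
    toℚᵘ (fromℤ a * fromℤ b)             ∎)
    where
    open ℚᵘ.≃-Reasoning
    clear-denominators : ∀ a b → a ℤ.* b ℤ.* + 1 ≡ a ℤ.* b ℤ.* (+ 1 ℤ.* + 1)
    clear-denominators = solve-∀

  fromℤ-homo‿- : ∀ a → fromℤ (ℤ.- a) ≡ - fromℤ a
  fromℤ-homo‿- a = ℚ.toℚᵘ-injective (begin
    toℚᵘ (fromℤ (ℤ.- a))   ≈⟨ toℚᵘ-fromℤ (ℤ.- a) ⟩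
    mkℚᵘ (ℤ.- a) 0         ≈⟨ ℚᵘ.-‿cong (toℚᵘ-fromℤ a) ⟨
    ℚᵘ.- toℚᵘ (fromℤ a)    ≈⟨ ℚ.toℚᵘ-homo‿- (fromℤ a) ⟨
    toℚᵘ (- fromℤ a)       ∎)
    where open ℚᵘ.≃-Reasoning

  fromℕ-homo-+ : ∀ m n → fromℕ (m ℕ.+ n) ≡ fromℕ m + fromℕ n
  fromℕ-homo-+ m n = fromℤ-homo-+ (+ m) (+ n)

  fromℕ-homo-* : ∀ m n → fromℕ (m ℕ.* n) ≡ fromℕ m * fromℕ n
  fromℕ-homo-* m n = trans (cong fromℤ (ℤ.pos-* m n)) (fromℤ-homo-* (+ m) (+ n))

  1/suc : ℕ → ℚ
  1/suc n = + 1 ℚ./ suc n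

  fromℕ-suc-*-1/suc : ∀ n → fromℕ (suc n) * 1/suc n ≡ 1ℚ
  fromℕ-suc-*-1/suc n = ℚ.toℚᵘ-injective (begin
    toℚᵘ (fromℕ (suc n) * 1/suc n)                ≈⟨ ℚ.toℚᵘ-homo-* (fromℕ (suc n)) (1/suc n) ⟩
    toℚᵘ (fromℕ (suc n)) ℚᵘ.* toℚᵘ (1/suc n)      ≈⟨ ℚᵘ.*-cong (toℚᵘ-fromℤ (+ suc n)) (ℚ.toℚᵘ-fromℚᵘ (mkℚᵘ (+ 1) n)) ⟩
    mkℚᵘ (+ suc n) 0 ℚᵘ.* mkℚᵘ (+ 1) n            ≈⟨ *≡* (cong (+_) (clear-denominators n)) ⟩
    ℚᵘ.1ℚᵘ                                        ∎)
    where
    open ℚᵘ.≃-Reasoning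
    clear-denominators : ∀ n → suc n ℕ.* 1 ℕ.* 1 ≡ 1 ℕ.* (1 ℕ.* suc n)
    clear-denominators = NatSolver.solve-∀

-- Formal power series: derivative and Cauchy product
module _ where
  open import Data.Rational as ℚ using (ℚ; 0ℚ; 1ℚ; _+_; _*_; -_)
  import Data.Rational.Properties as ℚ
  open import Algebra.Properties.CommutativeSemigroup
    (CommutativeMonoid.commutativeSemigroup ℚ.*-1-commutativeMonoid) using (x∙yz≈y∙xz)
  open ≡-Reasoning

  *-cancelˡ-fromℕ-suc : ∀ n {x y} → fromℕ (suc n) * x ≡ fromℕ (suc n) * y → x ≡ y
  *-cancelˡ-fromℕ-suc n {x} {y} eq = begin
    x                               ≡⟨ divide x ⟩
    1/suc n * (fromℕ (suc n) * x)   ≡⟨ cong (1/suc n *_) eq ⟩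
    1/suc n * (fromℕ (suc n) * y)   ≡⟨ divide y ⟨
    y                               ∎
    where
    divide : ∀ z → z ≡ 1/suc n * (fromℕ (suc n) * z)
    divide z = begin
      z                               ≡⟨ ℚ.*-identityˡ z ⟨
      1ℚ * z                          ≡⟨ cong (_* z) (fromℕ-suc-*-1/suc n) ⟨
      fromℕ (suc n) * 1/suc n * z     ≡⟨ cong (_* z) (ℚ.*-comm (fromℕ (suc n)) (1/suc n)) ⟩
      1/suc n * fromℕ (suc n) * z     ≡⟨ ℚ.*-assoc (1/suc n) (fromℕ (suc n)) z ⟩
      1/suc n * (fromℕ (suc n) * z)   ∎

  fromℕ-suc-*-invFact-suc : ∀ n x → fromℕ (suc n) * (x * invFact (suc n)) ≡ x * invFact n
  fromℕ-suc-*-invFact-suc n x = begin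
    fromℕ (suc n) * (x * (1/suc n * invFact n))    ≡⟨ x∙yz≈y∙xz (fromℕ (suc n)) x (1/suc n * invFact n) ⟩
    x * (fromℕ (suc n) * (1/suc n * invFact n))    ≡⟨ cong (x *_) (ℚ.*-assoc (fromℕ (suc n)) (1/suc n) (invFact n)) ⟨
    x * (fromℕ (suc n) * 1/suc n * invFact n)      ≡⟨ cong (λ y → x * (y * invFact n)) (fromℕ-suc-*-1/suc n) ⟩
    x * (1ℚ * invFact n)                           ≡⟨ cong (x *_) (ℚ.*-identityˡ (invFact n)) ⟩
    x * invFact n                                  ∎

  sumUpTo-cong : ∀ n {f g : ℕ → ℚ} → (∀ i → i ℕ.≤ n → f i ≡ g i) → sumUpTo n f ≡ sumUpTo n g
  sumUpTo-cong zero    f≡g = f≡g 0 ℕ.z≤n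
  sumUpTo-cong (suc n) f≡g =
    cong₂ _+_ (sumUpTo-cong n (λ i i≤n → f≡g i (ℕ.m≤n⇒m≤1+n i≤n))) (f≡g (suc n) ℕ.≤-refl)

  sumUpTo-+ : ∀ n (f g : ℕ → ℚ) → sumUpTo n (λ i → f i + g i) ≡ sumUpTo n f + sumUpTo n g
  sumUpTo-+ zero    f g = refl
  sumUpTo-+ (suc n) f g = begin
    sumUpTo n (λ i → f i + g i) + (f (suc n) + g (suc n))    ≡⟨ cong (_+ (f (suc n) + g (suc n))) (sumUpTo-+ n f g) ⟩
    sumUpTo n f + sumUpTo n g + (f (suc n) + g (suc n))      ≡⟨ interchange (sumUpTo n f) (sumUpTo n g) (f (suc n)) (g (suc n)) ⟩
    sumUpTo n f + f (suc n) + (sumUpTo n g + g (suc n))      ∎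
    where
    interchange : ∀ a b c d → a + b + (c + d) ≡ a + c + (b + d)
    interchange = RingSolver.solve-∀ ℚ-ring

  sumUpTo-*ˡ : ∀ n c (f : ℕ → ℚ) → sumUpTo n (λ i → c * f i) ≡ c * sumUpTo n f
  sumUpTo-*ˡ zero    c f = refl
  sumUpTo-*ˡ (suc n) c f =
    trans (cong (_+ c * f (suc n)) (sumUpTo-*ˡ n c f)) (sym (ℚ.*-distribˡ-+ c (sumUpTo n f) (f (suc n))))

  sumUpTo-0 : ∀ n (f : ℕ → ℚ) → (∀ i → f i ≡ 0ℚ) → sumUpTo n f ≡ 0ℚ
  sumUpTo-0 zero    f f≡0 = f≡0 0
  sumUpTo-0 (suc n) f f≡0 = cong₂ _+_ (sumUpTo-0 n f f≡0) (f≡0 (suc n))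

  sumUpTo-suc : ∀ n (f : ℕ → ℚ) → sumUpTo (suc n) f ≡ f 0 + sumUpTo n (f ∘ suc)
  sumUpTo-suc zero    f = refl
  sumUpTo-suc (suc n) f =
    trans (cong (_+ f (suc (suc n))) (sumUpTo-suc n f)) (ℚ.+-assoc (f 0) _ _)

  ∂ : FPS → FPS
  ∂ f n = fromℕ (suc n) * f (suc n)

  infixl 6 _⊕_
  _⊕_ : FPS → FPS → FPS
  (f ⊕ g) n = f n + g n

  infixr 7 _·_
  _·_ : ℚ → FPS → FPS
  (c · f) n = c * f n

  ∂-⊛ : ∀ f g → ∂ (f ⊛ g) ≗ ∂ f ⊛ g ⊕ f ⊛ ∂ g
  ∂-⊛ f g n = begin
    fromℕ (suc n) * sumUpTo (suc n) t                       ≡⟨ sumUpTo-*ˡ (suc n) (fromℕ (suc n)) t ⟨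
    sumUpTo (suc n) (λ i → fromℕ (suc n) * t i)             ≡⟨ sumUpTo-cong (suc n) split ⟩
    sumUpTo (suc n) (λ i → fromℕ i * t i + fromℕ (suc n ℕ.∸ i) * t i)
      ≡⟨ sumUpTo-+ (suc n) (λ i → fromℕ i * t i) (λ i → fromℕ (suc n ℕ.∸ i) * t i) ⟩
    sumUpTo (suc n) (λ i → fromℕ i * t i) + sumUpTo (suc n) (λ i → fromℕ (suc n ℕ.∸ i) * t i)
      ≡⟨ cong₂ _+_ differentiateLeft differentiateRight ⟩
    (∂ f ⊛ g) n + (f ⊛ ∂ g) n                               ∎
    where
    t : ℕ → ℚ
    t i = f i * g (suc n ℕ.∸ i)

    split : ∀ i → i ℕ.≤ suc n → fromℕ (suc n) * t i ≡ fromℕ i * t i + fromℕ (suc n ℕ.∸ i) * t i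
    split i i≤1+n = begin
      fromℕ (suc n) * t i                             ≡⟨ cong (λ m → fromℕ m * t i) (ℕ.m+[n∸m]≡n i≤1+n) ⟨
      fromℕ (i ℕ.+ (suc n ℕ.∸ i)) * t i               ≡⟨ cong (_* t i) (fromℕ-homo-+ i (suc n ℕ.∸ i)) ⟩
      (fromℕ i + fromℕ (suc n ℕ.∸ i)) * t i           ≡⟨ ℚ.*-distribʳ-+ (t i) (fromℕ i) (fromℕ (suc n ℕ.∸ i)) ⟩
      fromℕ i * t i + fromℕ (suc n ℕ.∸ i) * t i       ∎

    0*x+y≡y : ∀ x y → 0ℚ * x + y ≡ y
    0*x+y≡y = RingSolver.solve-∀ ℚ-ring

    y+0*x≡y : ∀ x y → y + 0ℚ * x ≡ y
    y+0*x≡y = RingSolver.solve-∀ ℚ-ring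

    differentiateLeft : sumUpTo (suc n) (λ i → fromℕ i * t i) ≡ (∂ f ⊛ g) n
    differentiateLeft = begin
      sumUpTo (suc n) (λ i → fromℕ i * t i)                        ≡⟨ sumUpTo-suc n (λ i → fromℕ i * t i) ⟩
      0ℚ * t 0 + sumUpTo n (λ i → fromℕ (suc i) * t (suc i))       ≡⟨ 0*x+y≡y (t 0) _ ⟩
      sumUpTo n (λ i → fromℕ (suc i) * (f (suc i) * g (n ℕ.∸ i)))
        ≡⟨ sumUpTo-cong n (λ i _ → sym (ℚ.*-assoc (fromℕ (suc i)) (f (suc i)) (g (n ℕ.∸ i)))) ⟩
      (∂ f ⊛ g) n                                                  ∎

    differentiateRight : sumUpTo (suc n) (λ i → fromℕ (suc n ℕ.∸ i) * t i) ≡ (f ⊛ ∂ g) n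
    differentiateRight = begin
      sumUpTo n (λ i → fromℕ (suc n ℕ.∸ i) * t i) + fromℕ (n ℕ.∸ n) * t (suc n)
        ≡⟨ cong (λ m → sumUpTo n (λ i → fromℕ (suc n ℕ.∸ i) * t i) + fromℕ m * t (suc n)) (ℕ.n∸n≡0 n) ⟩
      sumUpTo n (λ i → fromℕ (suc n ℕ.∸ i) * t i) + 0ℚ * t (suc n)
        ≡⟨ y+0*x≡y (t (suc n)) _ ⟩
      sumUpTo n (λ i → fromℕ (suc n ℕ.∸ i) * (f i * g (suc n ℕ.∸ i)))
        ≡⟨ sumUpTo-cong n (λ i i≤n → cong (λ m → fromℕ m * (f i * g m)) (ℕ.+-∸-assoc 1 i≤n)) ⟩
      sumUpTo n (λ i → fromℕ (suc (n ℕ.∸ i)) * (f i * g (suc (n ℕ.∸ i))))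
        ≡⟨ sumUpTo-cong n (λ i _ → x∙yz≈y∙xz (fromℕ (suc (n ℕ.∸ i))) (f i) (g (suc (n ℕ.∸ i)))) ⟩
      (f ⊛ ∂ g) n                                                  ∎

  ∂-injective : ∀ {f g} → f 0 ≡ g 0 → ∂ f ≗ ∂ g → f ≗ g
  ∂-injective f0≡g0 ∂f≗∂g zero    = f0≡g0
  ∂-injective f0≡g0 ∂f≗∂g (suc n) = *-cancelˡ-fromℕ-suc n (∂f≗∂g n)

  ∂-oneS : ∂ oneS ≗ const 0ℚ
  ∂-oneS n = ℚ.*-zeroʳ (fromℕ (suc n))

  ∂-⊕ : ∀ f g → ∂ (f ⊕ g) ≗ ∂ f ⊕ ∂ g
  ∂-⊕ f g n = ℚ.*-distribˡ-+ (fromℕ (suc n)) (f (suc n)) (g (suc n))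

  ∂-· : ∀ c f → ∂ (c · f) ≗ c · ∂ f
  ∂-· c f n = x∙yz≈y∙xz (fromℕ (suc n)) c (f (suc n))

  ⊛-congˡ : ∀ {f f′} g → f ≗ f′ → f ⊛ g ≗ f′ ⊛ g
  ⊛-congˡ g f≗f′ n = sumUpTo-cong n (λ i _ → cong (_* g (n ℕ.∸ i)) (f≗f′ i))

  ⊛-congʳ : ∀ f {g g′} → g ≗ g′ → f ⊛ g ≗ f ⊛ g′
  ⊛-congʳ f g≗g′ n = sumUpTo-cong n (λ i _ → cong (f i *_) (g≗g′ (n ℕ.∸ i)))

  ⊛-distribʳ-⊕ : ∀ h f g → (f ⊕ g) ⊛ h ≗ f ⊛ h ⊕ g ⊛ h
  ⊛-distribʳ-⊕ h f g n =
    trans (sumUpTo-cong n (λ i _ → ℚ.*-distribʳ-+ (h (n ℕ.∸ i)) (f i) (g i))) (sumUpTo-+ n _ _)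

  ⊛-distribˡ-⊕ : ∀ h f g → h ⊛ (f ⊕ g) ≗ h ⊛ f ⊕ h ⊛ g
  ⊛-distribˡ-⊕ h f g n =
    trans (sumUpTo-cong n (λ i _ → ℚ.*-distribˡ-+ (h i) (f (n ℕ.∸ i)) (g (n ℕ.∸ i)))) (sumUpTo-+ n _ _)

  ⊛-·ˡ : ∀ c f g → (c · f) ⊛ g ≗ c · (f ⊛ g)
  ⊛-·ˡ c f g n = trans (sumUpTo-cong n (λ i _ → ℚ.*-assoc c (f i) (g (n ℕ.∸ i)))) (sumUpTo-*ˡ n c _)

  ⊛-·ʳ : ∀ c f g → f ⊛ (c · g) ≗ c · (f ⊛ g)
  ⊛-·ʳ c f g n = trans (sumUpTo-cong n (λ i _ → x∙yz≈y∙xz (f i) c (g (n ℕ.∸ i)))) (sumUpTo-*ˡ n c _)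

  ⊛-zeroʳ : ∀ f {g} → g ≗ const 0ℚ → f ⊛ g ≗ const 0ℚ
  ⊛-zeroʳ f g≗0 n = sumUpTo-0 n _ (λ i → trans (cong (f i *_) (g≗0 (n ℕ.∸ i))) (ℚ.*-zeroʳ (f i)))

  ⊛-comm : ∀ f g → f ⊛ g ≗ g ⊛ f
  ⊛-comm f g zero    = ℚ.*-comm (f 0) (g 0)
  ⊛-comm f g (suc n) = *-cancelˡ-fromℕ-suc n (begin
    ∂ (f ⊛ g) n                    ≡⟨ ∂-⊛ f g n ⟩
    (∂ f ⊛ g) n + (f ⊛ ∂ g) n      ≡⟨ cong₂ _+_ (⊛-comm (∂ f) g n) (⊛-comm f (∂ g) n) ⟩
    (g ⊛ ∂ f) n + (∂ g ⊛ f) n      ≡⟨ ℚ.+-comm ((g ⊛ ∂ f) n) ((∂ g ⊛ f) n) ⟩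
    (∂ g ⊛ f) n + (g ⊛ ∂ f) n      ≡⟨ ∂-⊛ g f n ⟨
    ∂ (g ⊛ f) n                    ∎)

  ⊛-assoc : ∀ f g h → (f ⊛ g) ⊛ h ≗ f ⊛ (g ⊛ h)
  ⊛-assoc f g h zero    = ℚ.*-assoc (f 0) (g 0) (h 0)
  ⊛-assoc f g h (suc n) = *-cancelˡ-fromℕ-suc n (begin
    ∂ ((f ⊛ g) ⊛ h) n
      ≡⟨ ∂-⊛ (f ⊛ g) h n ⟩
    (∂ (f ⊛ g) ⊛ h) n + ((f ⊛ g) ⊛ ∂ h) n
      ≡⟨ cong (_+ ((f ⊛ g) ⊛ ∂ h) n) (trans (⊛-congˡ h (∂-⊛ f g) n) (⊛-distribʳ-⊕ h (∂ f ⊛ g) (f ⊛ ∂ g) n)) ⟩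
    ((∂ f ⊛ g) ⊛ h) n + ((f ⊛ ∂ g) ⊛ h) n + ((f ⊛ g) ⊛ ∂ h) n
      ≡⟨ cong₂ _+_ (cong₂ _+_ (⊛-assoc (∂ f) g h n) (⊛-assoc f (∂ g) h n)) (⊛-assoc f g (∂ h) n) ⟩
    (∂ f ⊛ (g ⊛ h)) n + (f ⊛ (∂ g ⊛ h)) n + (f ⊛ (g ⊛ ∂ h)) n
      ≡⟨ ℚ.+-assoc ((∂ f ⊛ (g ⊛ h)) n) ((f ⊛ (∂ g ⊛ h)) n) ((f ⊛ (g ⊛ ∂ h)) n) ⟩
    (∂ f ⊛ (g ⊛ h)) n + ((f ⊛ (∂ g ⊛ h)) n + (f ⊛ (g ⊛ ∂ h)) n)
      ≡⟨ cong (λ x → (∂ f ⊛ (g ⊛ h)) n + x) (trans (⊛-congʳ f (∂-⊛ g h) n) (⊛-distribˡ-⊕ f (∂ g ⊛ h) (g ⊛ ∂ h) n)) ⟨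
    (∂ f ⊛ (g ⊛ h)) n + (f ⊛ ∂ (g ⊛ h)) n
      ≡⟨ ∂-⊛ f (g ⊛ h) n ⟨
    ∂ (f ⊛ (g ⊛ h)) n
      ∎)

  ⊛-identityʳ : ∀ f → f ⊛ oneS ≗ f
  ⊛-identityʳ f zero    = ℚ.*-identityʳ (f 0)
  ⊛-identityʳ f (suc n) = *-cancelˡ-fromℕ-suc n (begin
    ∂ (f ⊛ oneS) n                        ≡⟨ ∂-⊛ f oneS n ⟩
    (∂ f ⊛ oneS) n + (f ⊛ ∂ oneS) n       ≡⟨ cong₂ _+_ (⊛-identityʳ (∂ f) n) (⊛-zeroʳ f ∂-oneS n) ⟩
    ∂ f n + 0ℚ                            ≡⟨ ℚ.+-identityʳ (∂ f n) ⟩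
    ∂ f n                                 ∎)

  ⊛-identityˡ : ∀ f → oneS ⊛ f ≗ f
  ⊛-identityˡ f n = trans (⊛-comm oneS f n) (⊛-identityʳ f n)

  ⊛-isCommutativeMonoid : IsCommutativeMonoid _≗_ _⊛_ oneS
  ⊛-isCommutativeMonoid = record
    { isMonoid = record
      { isSemigroup = record
        { isMagma = record
          { isEquivalence = Setoid.isEquivalence (ℕ →-setoid ℚ)
          ; ∙-cong = λ {f} {f′} {g} f≗f′ g≗g′ n → trans (⊛-congˡ g f≗f′ n) (⊛-congʳ f′ g≗g′ n)
          }
        ; assoc = ⊛-assoc
        }
      ; identity = ⊛-identityˡ , ⊛-identityʳ
      }
    ; comm = ⊛-comm
    }

  ⊛-commutativeMonoid : CommutativeMonoid 0ℓ 0ℓ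
  ⊛-commutativeMonoid = record { isCommutativeMonoid = ⊛-isCommutativeMonoid }

-- 2 sin(x/2) and the coefficients of the powers of its square
module _ where
  open import Data.Bool using (Bool; true; false; if_then_else_)
  import Data.Nat.DivMod as ℕ
  open import Data.Rational as ℚ using (ℚ; 0ℚ; 1ℚ; _+_; _*_; -_)
  import Data.Rational.Properties as ℚ
  open import Algebra.Properties.CommutativeSemigroup
    (CommutativeMonoid.commutativeSemigroup ℚ.*-1-commutativeMonoid) using (x∙yz≈z∙xy)
  open import Relation.Nullary.Decidable using (does)
  module ⊛ = CommutativeMonoid ⊛-commutativeMonoid
  open import Algebra.Properties.CommutativeSemigroup ⊛.commutativeSemigroup
    using () renaming (interchange to ⊛-interchange; x∙yz≈y∙xz to ⊛-x∙yz≈y∙xz)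
  open ≡-Reasoning

  ½ ¼ : ℚ
  ½ = + 1 ℚ./ 2
  ¼ = + 1 ℚ./ 4

  ∂²-twoSinHalf : ∂ (∂ twoSinHalf) ≗ (- ¼) · twoSinHalf
  ∂²-twoSinHalf n = begin
    fromℕ (suc n) * (fromℕ (suc (suc n)) * twoSinHalf (suc (suc n)))
      ≡⟨ cong₂ (λ p q → fromℕ (suc n) * (fromℕ (suc (suc n)) * term (does (p ℕ.≟ 1)) q (suc (suc n))))
               [2+n]%2≡n%2 [2+n]/2≡1+n/2 ⟩
    fromℕ (suc n) * (fromℕ (suc (suc n)) * term parity (suc (n ℕ./ 2)) (suc (suc n)))
      ≡⟨ ∂²-term parity ⟩
    (- ¼) * twoSinHalf n
      ∎
    where
    term : Bool → ℕ → ℕ → ℚ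
    term b q i = if b then fromℕ 2 * ((- 1ℚ) ^ℚ q) * (½ ^ℚ i) * invFact i else 0ℚ

    parity : Bool
    parity = does (n ℕ.% 2 ℕ.≟ 1)

    [2+n]%2≡n%2 : suc (suc n) ℕ.% 2 ≡ n ℕ.% 2
    [2+n]%2≡n%2 = trans (cong (ℕ._% 2) (ℕ.+-comm 2 n)) (ℕ.[m+n]%n≡m%n n 2)

    [2+n]/2≡1+n/2 : suc (suc n) ℕ./ 2 ≡ suc (n ℕ./ 2)
    [2+n]/2≡1+n/2 = ℕ.m/n≡1+[m∸n]/n {suc (suc n)} (ℕ.s≤s (ℕ.s≤s ℕ.z≤n))

    ∂²-term : ∀ b → fromℕ (suc n) * (fromℕ (suc (suc n)) * term b (suc (n ℕ./ 2)) (suc (suc n)))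
                    ≡ (- ¼) * term b (n ℕ./ 2) n
    ∂²-term false = vanish (fromℕ (suc n)) (fromℕ (suc (suc n)))
      where
      vanish : ∀ A B → A * (B * 0ℚ) ≡ (- ¼) * 0ℚ
      vanish = RingSolver.solve-∀ ℚ-ring
    ∂²-term true  = begin
      A * (B * (fromℕ 2 * (- 1ℚ * P) * (½ * (½ * H)) * (b * (a * I))))
        ≡⟨ regroup A B a b P H I ⟩
      (A * a) * (B * b) * ((- ¼) * (fromℕ 2 * P * H * I))
        ≡⟨ cong₂ (λ x y → x * y * ((- ¼) * (fromℕ 2 * P * H * I))) (fromℕ-suc-*-1/suc n) (fromℕ-suc-*-1/suc (suc n)) ⟩
      1ℚ * 1ℚ * ((- ¼) * (fromℕ 2 * P * H * I))
        ≡⟨ ℚ.*-identityˡ _ ⟩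
      (- ¼) * (fromℕ 2 * P * H * I)
        ∎
      where
      A = fromℕ (suc n)
      B = fromℕ (suc (suc n))
      a = 1/suc n
      b = 1/suc (suc n)
      P = (- 1ℚ) ^ℚ (n ℕ./ 2)
      H = ½ ^ℚ n
      I = invFact n
      regroup : ∀ A B a b P H I → A * (B * (fromℕ 2 * (- 1ℚ * P) * (½ * (½ * H)) * (b * (a * I))))
                                  ≡ (A * a) * (B * b) * ((- ¼) * (fromℕ 2 * P * H * I))
      regroup = RingSolver.solve-∀ ℚ-ring

  twoCosHalf : FPS
  twoCosHalf = fromℕ 2 · ∂ twoSinHalf

  ∂-twoSinHalf : ∂ twoSinHalf ≗ ½ · twoCosHalf
  ∂-twoSinHalf n = x≡½*[2*x] (∂ twoSinHalf n)
    where
    x≡½*[2*x] : ∀ x → x ≡ ½ * (fromℕ 2 * x)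
    x≡½*[2*x] = RingSolver.solve-∀ ℚ-ring

  ∂-twoCosHalf : ∂ twoCosHalf ≗ (- ½) · twoSinHalf
  ∂-twoCosHalf n = begin
    ∂ (fromℕ 2 · ∂ twoSinHalf) n         ≡⟨ ∂-· (fromℕ 2) (∂ twoSinHalf) n ⟩
    fromℕ 2 * ∂ (∂ twoSinHalf) n         ≡⟨ cong (fromℕ 2 *_) (∂²-twoSinHalf n) ⟩
    fromℕ 2 * ((- ¼) * twoSinHalf n)     ≡⟨ 2*[-¼*x]≡-½*x (twoSinHalf n) ⟩
    (- ½) * twoSinHalf n                 ∎
    where
    2*[-¼*x]≡-½*x : ∀ x → fromℕ 2 * ((- ¼) * x) ≡ (- ½) * x
    2*[-¼*x]≡-½*x = RingSolver.solve-∀ ℚ-ring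

  ∂-cong : ∀ {f g} → f ≗ g → ∂ f ≗ ∂ g
  ∂-cong f≗g n = cong (fromℕ (suc n) *_) (f≗g (suc n))

  ∂-twoSinHalfSq : ∂ twoSinHalfSq ≗ twoSinHalf ⊛ twoCosHalf
  ∂-twoSinHalfSq n = begin
    ∂ (twoSinHalf ⊛ twoSinHalf) n
      ≡⟨ ∂-⊛ twoSinHalf twoSinHalf n ⟩
    (∂ twoSinHalf ⊛ twoSinHalf) n + (twoSinHalf ⊛ ∂ twoSinHalf) n
      ≡⟨ cong₂ _+_ (trans (⊛-congˡ twoSinHalf ∂-twoSinHalf n) (⊛-·ˡ ½ twoCosHalf twoSinHalf n))
                   (trans (⊛-congʳ twoSinHalf ∂-twoSinHalf n) (⊛-·ʳ ½ twoSinHalf twoCosHalf n)) ⟩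
    ½ * (twoCosHalf ⊛ twoSinHalf) n + ½ * (twoSinHalf ⊛ twoCosHalf) n
      ≡⟨ cong (λ x → ½ * x + ½ * (twoSinHalf ⊛ twoCosHalf) n) (⊛-comm twoCosHalf twoSinHalf n) ⟩
    ½ * (twoSinHalf ⊛ twoCosHalf) n + ½ * (twoSinHalf ⊛ twoCosHalf) n
      ≡⟨ ½*x+½*x≡x ((twoSinHalf ⊛ twoCosHalf) n) ⟩
    (twoSinHalf ⊛ twoCosHalf) n
      ∎
    where
    ½*x+½*x≡x : ∀ x → ½ * x + ½ * x ≡ x
    ½*x+½*x≡x = RingSolver.solve-∀ ℚ-ring

  pythagoras : twoCosHalf ⊛ twoCosHalf ≗ fromℕ 4 · oneS ⊕ (- 1ℚ) · twoSinHalfSq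
  pythagoras = ∂-injective refl λ n → begin
    ∂ (twoCosHalf ⊛ twoCosHalf) n
      ≡⟨ ∂-⊛ twoCosHalf twoCosHalf n ⟩
    (∂ twoCosHalf ⊛ twoCosHalf) n + (twoCosHalf ⊛ ∂ twoCosHalf) n
      ≡⟨ cong₂ _+_ (trans (⊛-congˡ twoCosHalf ∂-twoCosHalf n) (⊛-·ˡ (- ½) twoSinHalf twoCosHalf n))
                   (trans (⊛-congʳ twoCosHalf ∂-twoCosHalf n) (⊛-·ʳ (- ½) twoCosHalf twoSinHalf n)) ⟩
    (- ½) * (twoSinHalf ⊛ twoCosHalf) n + (- ½) * (twoCosHalf ⊛ twoSinHalf) n
      ≡⟨ cong (λ x → (- ½) * (twoSinHalf ⊛ twoCosHalf) n + (- ½) * x) (⊛-comm twoCosHalf twoSinHalf n) ⟩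
    (- ½) * (twoSinHalf ⊛ twoCosHalf) n + (- ½) * (twoSinHalf ⊛ twoCosHalf) n
      ≡⟨ -½*x+-½*x≡4*0+-1*x ((twoSinHalf ⊛ twoCosHalf) n) ⟩
    fromℕ 4 * 0ℚ + (- 1ℚ) * (twoSinHalf ⊛ twoCosHalf) n
      ≡⟨ cong₂ (λ x y → fromℕ 4 * x + (- 1ℚ) * y) (∂-oneS n) (∂-twoSinHalfSq n) ⟨
    fromℕ 4 * ∂ oneS n + (- 1ℚ) * ∂ twoSinHalfSq n
      ≡⟨ cong₂ _+_ (∂-· (fromℕ 4) oneS n) (∂-· (- 1ℚ) twoSinHalfSq n) ⟨
    ∂ (fromℕ 4 · oneS) n + ∂ ((- 1ℚ) · twoSinHalfSq) n
      ≡⟨ ∂-⊕ (fromℕ 4 · oneS) ((- 1ℚ) · twoSinHalfSq) n ⟨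
    ∂ (fromℕ 4 · oneS ⊕ (- 1ℚ) · twoSinHalfSq) n
      ∎
    where
    -½*x+-½*x≡4*0+-1*x : ∀ x → (- ½) * x + (- ½) * x ≡ fromℕ 4 * 0ℚ + (- 1ℚ) * x
    -½*x+-½*x≡4*0+-1*x = RingSolver.solve-∀ ℚ-ring

  ∂²-twoSinHalfSq : ∂ (∂ twoSinHalfSq) ≗ fromℕ 2 · oneS ⊕ (- 1ℚ) · twoSinHalfSq
  ∂²-twoSinHalfSq n = begin
    ∂ (∂ twoSinHalfSq) n
      ≡⟨ ∂-cong ∂-twoSinHalfSq n ⟩
    ∂ (twoSinHalf ⊛ twoCosHalf) n
      ≡⟨ ∂-⊛ twoSinHalf twoCosHalf n ⟩
    (∂ twoSinHalf ⊛ twoCosHalf) n + (twoSinHalf ⊛ ∂ twoCosHalf) n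
      ≡⟨ cong₂ _+_ (trans (⊛-congˡ twoCosHalf ∂-twoSinHalf n) (⊛-·ˡ ½ twoCosHalf twoCosHalf n))
                   (trans (⊛-congʳ twoSinHalf ∂-twoCosHalf n) (⊛-·ʳ (- ½) twoSinHalf twoSinHalf n)) ⟩
    ½ * (twoCosHalf ⊛ twoCosHalf) n + (- ½) * twoSinHalfSq n
      ≡⟨ cong (λ x → ½ * x + (- ½) * twoSinHalfSq n) (pythagoras n) ⟩
    ½ * (fromℕ 4 * oneS n + (- 1ℚ) * twoSinHalfSq n) + (- ½) * twoSinHalfSq n
      ≡⟨ simplify (oneS n) (twoSinHalfSq n) ⟩
    fromℕ 2 * oneS n + (- 1ℚ) * twoSinHalfSq n
      ∎
    where
    simplify : ∀ x y → ½ * (fromℕ 4 * x + (- 1ℚ) * y) + (- ½) * y ≡ fromℕ 2 * x + (- 1ℚ) * y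
    simplify = RingSolver.solve-∀ ℚ-ring

  ∂twoSinHalfSq² : ∂ twoSinHalfSq ⊛ ∂ twoSinHalfSq ≗ fromℕ 4 · twoSinHalfSq ⊕ (- 1ℚ) · (twoSinHalfSq ⊛ twoSinHalfSq)
  ∂twoSinHalfSq² n = begin
    (∂ twoSinHalfSq ⊛ ∂ twoSinHalfSq) n
      ≡⟨ ⊛.∙-cong ∂-twoSinHalfSq ∂-twoSinHalfSq n ⟩
    ((twoSinHalf ⊛ twoCosHalf) ⊛ (twoSinHalf ⊛ twoCosHalf)) n
      ≡⟨ ⊛-interchange twoSinHalf twoCosHalf twoSinHalf twoCosHalf n ⟩
    (twoSinHalfSq ⊛ (twoCosHalf ⊛ twoCosHalf)) n
      ≡⟨ ⊛-congʳ twoSinHalfSq pythagoras n ⟩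
    (twoSinHalfSq ⊛ (fromℕ 4 · oneS ⊕ (- 1ℚ) · twoSinHalfSq)) n
      ≡⟨ ⊛-distribˡ-⊕ twoSinHalfSq (fromℕ 4 · oneS) ((- 1ℚ) · twoSinHalfSq) n ⟩
    (twoSinHalfSq ⊛ (fromℕ 4 · oneS)) n + (twoSinHalfSq ⊛ ((- 1ℚ) · twoSinHalfSq)) n
      ≡⟨ cong₂ _+_ (trans (⊛-·ʳ (fromℕ 4) twoSinHalfSq oneS n) (cong (fromℕ 4 *_) (⊛-identityʳ twoSinHalfSq n)))
                   (⊛-·ʳ (- 1ℚ) twoSinHalfSq twoSinHalfSq n) ⟩
    fromℕ 4 * twoSinHalfSq n + (- 1ℚ) * (twoSinHalfSq ⊛ twoSinHalfSq) n
      ∎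

  ∂-^S : ∀ f m → ∂ (f ^S suc m) ≗ fromℕ (suc m) · (∂ f ⊛ (f ^S m))
  ∂-^S f zero n = begin
    ∂ (f ⊛ oneS) n                      ≡⟨ ∂-⊛ f oneS n ⟩
    (∂ f ⊛ oneS) n + (f ⊛ ∂ oneS) n     ≡⟨ cong (λ x → (∂ f ⊛ oneS) n + x) (⊛-zeroʳ f ∂-oneS n) ⟩
    (∂ f ⊛ oneS) n + 0ℚ                 ≡⟨ x+0≡1*x ((∂ f ⊛ oneS) n) ⟩
    1ℚ * (∂ f ⊛ oneS) n                 ∎
    where
    x+0≡1*x : ∀ x → x + 0ℚ ≡ 1ℚ * x
    x+0≡1*x = RingSolver.solve-∀ ℚ-ring
  ∂-^S f (suc m) n = begin
    ∂ (f ⊛ (f ^S suc m)) n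
      ≡⟨ ∂-⊛ f (f ^S suc m) n ⟩
    (∂ f ⊛ (f ^S suc m)) n + (f ⊛ ∂ (f ^S suc m)) n
      ≡⟨ cong (λ x → (∂ f ⊛ (f ^S suc m)) n + x) (trans (⊛-congʳ f (∂-^S f m) n) (⊛-·ʳ (fromℕ (suc m)) f (∂ f ⊛ (f ^S m)) n)) ⟩
    (∂ f ⊛ (f ^S suc m)) n + fromℕ (suc m) * (f ⊛ (∂ f ⊛ (f ^S m))) n
      ≡⟨ cong (λ x → (∂ f ⊛ (f ^S suc m)) n + fromℕ (suc m) * x) (⊛-x∙yz≈y∙xz f (∂ f) (f ^S m) n) ⟩
    (∂ f ⊛ (f ^S suc m)) n + fromℕ (suc m) * (∂ f ⊛ (f ^S suc m)) n
      ≡⟨ x+k*x≡[1+k]*x ((∂ f ⊛ (f ^S suc m)) n) (fromℕ (suc m)) ⟩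
    (1ℚ + fromℕ (suc m)) * (∂ f ⊛ (f ^S suc m)) n
      ≡⟨ cong (_* (∂ f ⊛ (f ^S suc m)) n) (fromℕ-homo-+ 1 (suc m)) ⟨
    fromℕ (suc (suc m)) * (∂ f ⊛ (f ^S suc m)) n
      ∎
    where
    x+k*x≡[1+k]*x : ∀ x k → x + k * x ≡ (1ℚ + k) * x
    x+k*x≡[1+k]*x = RingSolver.solve-∀ ℚ-ring

  ∂²-twoSinHalfSq-⊛ : ∀ g → ∂ (∂ twoSinHalfSq) ⊛ g ≗ fromℕ 2 · g ⊕ (- 1ℚ) · (twoSinHalfSq ⊛ g)
  ∂²-twoSinHalfSq-⊛ g n = begin
    (∂ (∂ twoSinHalfSq) ⊛ g) n
      ≡⟨ ⊛-congˡ g ∂²-twoSinHalfSq n ⟩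
    ((fromℕ 2 · oneS ⊕ (- 1ℚ) · twoSinHalfSq) ⊛ g) n
      ≡⟨ ⊛-distribʳ-⊕ g (fromℕ 2 · oneS) ((- 1ℚ) · twoSinHalfSq) n ⟩
    ((fromℕ 2 · oneS) ⊛ g) n + (((- 1ℚ) · twoSinHalfSq) ⊛ g) n
      ≡⟨ cong₂ _+_ (trans (⊛-·ˡ (fromℕ 2) oneS g n) (cong (fromℕ 2 *_) (⊛-identityˡ g n)))
                   (⊛-·ˡ (- 1ℚ) twoSinHalfSq g n) ⟩
    fromℕ 2 * g n + (- 1ℚ) * (twoSinHalfSq ⊛ g) n
      ∎

  ∂twoSinHalfSq-⊛-∂^S : ∀ m → ∂ twoSinHalfSq ⊛ ∂ (twoSinHalfSq ^S m) ≗
    fromℕ m · (fromℕ 4 · twoSinHalfSq ^S m ⊕ (- 1ℚ) · twoSinHalfSq ^S suc m)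
  ∂twoSinHalfSq-⊛-∂^S zero n =
    trans (⊛-zeroʳ (∂ twoSinHalfSq) ∂-oneS n) (sym (ℚ.*-zeroˡ (fromℕ 4 * oneS n + (- 1ℚ) * (twoSinHalfSq ^S 1) n)))
  ∂twoSinHalfSq-⊛-∂^S (suc m) n = begin
    (∂S ⊛ ∂ (S ^S suc m)) n
      ≡⟨ ⊛-congʳ ∂S (∂-^S S m) n ⟩
    (∂S ⊛ (fromℕ (suc m) · (∂S ⊛ (S ^S m)))) n
      ≡⟨ ⊛-·ʳ (fromℕ (suc m)) ∂S (∂S ⊛ (S ^S m)) n ⟩
    fromℕ (suc m) * (∂S ⊛ (∂S ⊛ (S ^S m))) n
      ≡⟨ cong (fromℕ (suc m) *_) (⊛-assoc ∂S ∂S (S ^S m) n) ⟨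
    fromℕ (suc m) * ((∂S ⊛ ∂S) ⊛ (S ^S m)) n
      ≡⟨ cong (fromℕ (suc m) *_) (⊛-congˡ (S ^S m) ∂twoSinHalfSq² n) ⟩
    fromℕ (suc m) * ((fromℕ 4 · S ⊕ (- 1ℚ) · (S ⊛ S)) ⊛ (S ^S m)) n
      ≡⟨ cong (fromℕ (suc m) *_) (⊛-distribʳ-⊕ (S ^S m) (fromℕ 4 · S) ((- 1ℚ) · (S ⊛ S)) n) ⟩
    fromℕ (suc m) * (((fromℕ 4 · S) ⊛ (S ^S m)) n + (((- 1ℚ) · (S ⊛ S)) ⊛ (S ^S m)) n)
      ≡⟨ cong (fromℕ (suc m) *_) (cong₂ _+_ (⊛-·ˡ (fromℕ 4) S (S ^S m) n)
           (trans (⊛-·ˡ (- 1ℚ) (S ⊛ S) (S ^S m) n) (cong ((- 1ℚ) *_) (⊛-assoc S S (S ^S m) n)))) ⟩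
    fromℕ (suc m) * (fromℕ 4 * (S ^S suc m) n + (- 1ℚ) * (S ^S suc (suc m)) n)
      ∎
    where
    S = twoSinHalfSq
    ∂S = ∂ twoSinHalfSq

  ∂²-twoSinHalfSq^S : ∀ m → ∂ (∂ (twoSinHalfSq ^S suc m)) ≗
    fromℕ (2 ℕ.* suc m ℕ.* (2 ℕ.* m ℕ.+ 1)) · twoSinHalfSq ^S m ⊕
    (- fromℕ (suc m ℕ.* suc m)) · twoSinHalfSq ^S suc m
  ∂²-twoSinHalfSq^S m n = begin
    ∂ (∂ (S ^S suc m)) n
      ≡⟨ ∂-cong (∂-^S S m) n ⟩
    ∂ (fromℕ (suc m) · (∂S ⊛ (S ^S m))) n
      ≡⟨ ∂-· (fromℕ (suc m)) (∂S ⊛ (S ^S m)) n ⟩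
    fromℕ (suc m) * ∂ (∂S ⊛ (S ^S m)) n
      ≡⟨ cong (fromℕ (suc m) *_) (∂-⊛ ∂S (S ^S m) n) ⟩
    fromℕ (suc m) * ((∂ ∂S ⊛ (S ^S m)) n + (∂S ⊛ ∂ (S ^S m)) n)
      ≡⟨ cong (fromℕ (suc m) *_) (cong₂ _+_ (∂²-twoSinHalfSq-⊛ (S ^S m) n) (∂twoSinHalfSq-⊛-∂^S m n)) ⟩
    fromℕ (suc m) * ((fromℕ 2 * x + (- 1ℚ) * y) + fromℕ m * (fromℕ 4 * x + (- 1ℚ) * y))
      ≡⟨ cong (_* ((fromℕ 2 * x + (- 1ℚ) * y) + fromℕ m * (fromℕ 4 * x + (- 1ℚ) * y))) (fromℕ-homo-+ 1 m) ⟩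
    (1ℚ + fromℕ m) * ((fromℕ 2 * x + (- 1ℚ) * y) + fromℕ m * (fromℕ 4 * x + (- 1ℚ) * y))
      ≡⟨ expand (fromℕ m) x y ⟩
    fromℕ 2 * (1ℚ + fromℕ m) * (fromℕ 2 * fromℕ m + 1ℚ) * x + (- ((1ℚ + fromℕ m) * (1ℚ + fromℕ m))) * y
      ≡⟨ cong₂ (λ k l → k * x + (- l) * y) fromℕ-2[1+m][2m+1] fromℕ-[1+m][1+m] ⟨
    fromℕ (2 ℕ.* suc m ℕ.* (2 ℕ.* m ℕ.+ 1)) * x + (- fromℕ (suc m ℕ.* suc m)) * y
      ∎
    where
    S = twoSinHalfSq
    ∂S = ∂ twoSinHalfSq
    x = (S ^S m) n
    y = (S ^S suc m) n

    expand : ∀ q x y → (1ℚ + q) * ((fromℕ 2 * x + (- 1ℚ) * y) + q * (fromℕ 4 * x + (- 1ℚ) * y))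
                       ≡ fromℕ 2 * (1ℚ + q) * (fromℕ 2 * q + 1ℚ) * x + (- ((1ℚ + q) * (1ℚ + q))) * y
    expand = RingSolver.solve-∀ ℚ-ring

    fromℕ-2[1+m][2m+1] : fromℕ (2 ℕ.* suc m ℕ.* (2 ℕ.* m ℕ.+ 1)) ≡ fromℕ 2 * (1ℚ + fromℕ m) * (fromℕ 2 * fromℕ m + 1ℚ)
    fromℕ-2[1+m][2m+1] = begin
      fromℕ (2 ℕ.* suc m ℕ.* (2 ℕ.* m ℕ.+ 1))               ≡⟨ fromℕ-homo-* (2 ℕ.* suc m) (2 ℕ.* m ℕ.+ 1) ⟩
      fromℕ (2 ℕ.* suc m) * fromℕ (2 ℕ.* m ℕ.+ 1)           ≡⟨ cong₂ _*_ (fromℕ-homo-* 2 (suc m)) (fromℕ-homo-+ (2 ℕ.* m) 1) ⟩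
      fromℕ 2 * fromℕ (suc m) * (fromℕ (2 ℕ.* m) + 1ℚ)      ≡⟨ cong₂ (λ a b → fromℕ 2 * a * (b + 1ℚ)) (fromℕ-homo-+ 1 m) (fromℕ-homo-* 2 m) ⟩
      fromℕ 2 * (1ℚ + fromℕ m) * (fromℕ 2 * fromℕ m + 1ℚ)   ∎

    fromℕ-[1+m][1+m] : fromℕ (suc m ℕ.* suc m) ≡ (1ℚ + fromℕ m) * (1ℚ + fromℕ m)
    fromℕ-[1+m][1+m] = trans (fromℕ-homo-* (suc m) (suc m)) (cong₂ _*_ (fromℕ-homo-+ 1 m) (fromℕ-homo-+ 1 m))

  sinCoeff : ℕ → ℕ → ℤ
  sinCoeff zero    zero          = + 1
  sinCoeff (suc m) zero          = + 0
  sinCoeff _       (suc zero)    = + 0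
  sinCoeff zero    (suc (suc n)) = + 0
  sinCoeff (suc m) (suc (suc n)) =
    + (2 ℕ.* suc m ℕ.* (2 ℕ.* m ℕ.+ 1)) ℤ.* sinCoeff m n ℤ.- + (suc m ℕ.* suc m) ℤ.* sinCoeff (suc m) n

  twoSinHalfSq^S-coeff : ∀ m n → (twoSinHalfSq ^S m) n ≡ fromℤ (sinCoeff m n) * invFact n
  twoSinHalfSq^S-coeff zero    zero          = refl
  twoSinHalfSq^S-coeff (suc m) zero          = ℚ.*-zeroˡ ((twoSinHalfSq ^S m) 0)
  twoSinHalfSq^S-coeff zero    (suc zero)    = refl
  twoSinHalfSq^S-coeff (suc m) (suc zero)    =
    cong₂ _+_ (ℚ.*-zeroˡ ((twoSinHalfSq ^S m) 1)) (ℚ.*-zeroˡ ((twoSinHalfSq ^S m) 0))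
  twoSinHalfSq^S-coeff zero    (suc (suc n)) = sym (ℚ.*-zeroˡ (invFact (suc (suc n))))
  twoSinHalfSq^S-coeff (suc m) (suc (suc n)) =
    *-cancelˡ-fromℕ-suc (suc n) (*-cancelˡ-fromℕ-suc n (begin
    ∂ (∂ (twoSinHalfSq ^S suc m)) n
      ≡⟨ ∂²-twoSinHalfSq^S m n ⟩
    K * (twoSinHalfSq ^S m) n + (- L) * (twoSinHalfSq ^S suc m) n
      ≡⟨ cong₂ (λ x y → K * x + (- L) * y) (twoSinHalfSq^S-coeff m n) (twoSinHalfSq^S-coeff (suc m) n) ⟩
    K * (u * I) + (- L) * (v * I)
      ≡⟨ factor K L u v I ⟩
    (K * u + (- L) * v) * I
      ≡⟨ cong (_* I) fromℤ-recurrence ⟨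
    w * I
      ≡⟨ fromℕ-suc-*-invFact-suc n w ⟨
    fromℕ (suc n) * (w * invFact (suc n))
      ≡⟨ cong (fromℕ (suc n) *_) (fromℕ-suc-*-invFact-suc (suc n) w) ⟨
    fromℕ (suc n) * (fromℕ (suc (suc n)) * (w * invFact (suc (suc n))))
      ∎))
    where
    K = fromℕ (2 ℕ.* suc m ℕ.* (2 ℕ.* m ℕ.+ 1))
    L = fromℕ (suc m ℕ.* suc m)
    u = fromℤ (sinCoeff m n)
    v = fromℤ (sinCoeff (suc m) n)
    w = fromℤ (sinCoeff (suc m) (suc (suc n)))
    I = invFact n

    fromℤ-recurrence : w ≡ K * u + (- L) * v
    fromℤ-recurrence = begin
      fromℤ (+ k ℤ.* sinCoeff m n ℤ.+ ℤ.- (+ l ℤ.* sinCoeff (suc m) n))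
        ≡⟨ fromℤ-homo-+ (+ k ℤ.* sinCoeff m n) (ℤ.- (+ l ℤ.* sinCoeff (suc m) n)) ⟩
      fromℤ (+ k ℤ.* sinCoeff m n) + fromℤ (ℤ.- (+ l ℤ.* sinCoeff (suc m) n))
        ≡⟨ cong₂ _+_ (fromℤ-homo-* (+ k) (sinCoeff m n))
                     (trans (fromℤ-homo‿- (+ l ℤ.* sinCoeff (suc m) n)) (cong -_ (fromℤ-homo-* (+ l) (sinCoeff (suc m) n)))) ⟩
      K * u + - (L * v)
        ≡⟨ cong (λ z → K * u + z) (ℚ.neg-distribˡ-* L v) ⟩
      K * u + (- L) * v
        ∎
      where
      k = 2 ℕ.* suc m ℕ.* (2 ℕ.* m ℕ.+ 1)
      l = suc m ℕ.* suc m

    factor : ∀ K L u v I → K * (u * I) + (- L) * (v * I) ≡ (K * u + (- L) * v) * I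
    factor = RingSolver.solve-∀ ℚ-ring

  sumUpToℤ : ℕ → (ℕ → ℤ) → ℤ
  sumUpToℤ zero    f = f 0
  sumUpToℤ (suc n) f = sumUpToℤ n f ℤ.+ f (suc n)

  fromℤ-sumUpToℤ : ∀ n f → fromℤ (sumUpToℤ n f) ≡ sumUpTo n (fromℤ ∘ f)
  fromℤ-sumUpToℤ zero    f = refl
  fromℤ-sumUpToℤ (suc n) f =
    trans (fromℤ-homo-+ (sumUpToℤ n f) (f (suc n))) (cong (_+ fromℤ (f (suc n))) (fromℤ-sumUpToℤ n f))

  fromℕ-!-*-invFact : ∀ n → fromℕ (n !) * invFact n ≡ 1ℚ
  fromℕ-!-*-invFact zero    = refl
  fromℕ-!-*-invFact (suc n) = begin
    fromℕ (suc n ℕ.* n !) * invFact (suc n)                ≡⟨ cong (_* invFact (suc n)) (fromℕ-homo-* (suc n) (n !)) ⟩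
    fromℕ (suc n) * fromℕ (n !) * invFact (suc n)          ≡⟨ ℚ.*-assoc (fromℕ (suc n)) (fromℕ (n !)) (invFact (suc n)) ⟩
    fromℕ (suc n) * (fromℕ (n !) * invFact (suc n))        ≡⟨ fromℕ-suc-*-invFact-suc n (fromℕ (n !)) ⟩
    fromℕ (n !) * invFact n                                ≡⟨ fromℕ-!-*-invFact n ⟩
    1ℚ                                                     ∎

  polyBernoulli2ℤ : ℕ → ℕ → ℤ
  polyBernoulli2ℤ n k = sumUpToℤ n (λ m → + ((2 ℕ.* m ℕ.+ 1) ℕ.^ k) ℤ.* sinCoeff m n)

  polyBernoulli2≡fromℤ : ∀ n k → polyBernoulli2 n k ≡ fromℤ (polyBernoulli2ℤ n k)
  polyBernoulli2≡fromℤ n k = begin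
    fromℕ (n !) * sumUpTo n (λ m → fromℕ (e m) * (twoSinHalfSq ^S m) n)
      ≡⟨ cong (fromℕ (n !) *_) (sumUpTo-cong n (λ m _ → term m)) ⟩
    fromℕ (n !) * sumUpTo n (λ m → invFact n * fromℤ (b m))
      ≡⟨ cong (fromℕ (n !) *_) (sumUpTo-*ˡ n (invFact n) (fromℤ ∘ b)) ⟩
    fromℕ (n !) * (invFact n * sumUpTo n (fromℤ ∘ b))
      ≡⟨ ℚ.*-assoc (fromℕ (n !)) (invFact n) (sumUpTo n (fromℤ ∘ b)) ⟨
    fromℕ (n !) * invFact n * sumUpTo n (fromℤ ∘ b)
      ≡⟨ cong (_* sumUpTo n (fromℤ ∘ b)) (fromℕ-!-*-invFact n) ⟩
    1ℚ * sumUpTo n (fromℤ ∘ b)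
      ≡⟨ ℚ.*-identityˡ (sumUpTo n (fromℤ ∘ b)) ⟩
    sumUpTo n (fromℤ ∘ b)
      ≡⟨ fromℤ-sumUpToℤ n b ⟨
    fromℤ (polyBernoulli2ℤ n k)
      ∎
    where
    e : ℕ → ℕ
    e m = (2 ℕ.* m ℕ.+ 1) ℕ.^ k
    b : ℕ → ℤ
    b m = + e m ℤ.* sinCoeff m n
    term : ∀ m → fromℕ (e m) * (twoSinHalfSq ^S m) n ≡ invFact n * fromℤ (b m)
    term m = begin
      fromℕ (e m) * (twoSinHalfSq ^S m) n                ≡⟨ cong (fromℕ (e m) *_) (twoSinHalfSq^S-coeff m n) ⟩
      fromℕ (e m) * (fromℤ (sinCoeff m n) * invFact n)   ≡⟨ x∙yz≈z∙xy (fromℕ (e m)) (fromℤ (sinCoeff m n)) (invFact n) ⟩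
      invFact n * (fromℕ (e m) * fromℤ (sinCoeff m n))   ≡⟨ cong (invFact n *_) (fromℤ-homo-* (+ e m) (sinCoeff m n)) ⟨
      invFact n * fromℤ (b m)                            ∎

-- Congruences modulo 5
module _ where
  open import Data.Integer using (_+_; _*_; _-_; -_; _^_; _%ℕ_; _/ℕ_; 0ℤ; -1ℤ; ∣_∣)
  open import Data.Integer.DivMod using (a≡a%ℕn+[a/ℕn]*n; n%ℕd<d)
  open import Data.Integer.Divisibility.Signed
    using (_∣_; divides; ∣⇒∣ᵤ; ∣m⇒∣-m; ∣m∣n⇒∣m+n; ∣m∣n⇒∣m-n; ∣m⇒∣m*n; ∣n⇒∣m*n)
  import Data.Nat.Divisibility as ℕ
  import Data.Nat.DivMod as ℕ
  open import Relation.Nullary.Negation using (contradiction)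
  open ≡-Reasoning

  infix 4 _≡_mod_
  record _≡_mod_ (i j : ℤ) (d : ℕ) : Set where
    constructor ≡-mod
    field
      divides-difference : + d ∣ i - j

  ≡-mod-trans : ∀ {d i j k} → i ≡ j mod d → j ≡ k mod d → i ≡ k mod d
  ≡-mod-trans {i = i} {j} {k} (≡-mod d∣i-j) (≡-mod d∣j-k) =
    ≡-mod (subst (_ ∣_) (telescope i j k) (∣m∣n⇒∣m+n d∣i-j d∣j-k))
    where
    telescope : ∀ i j k → i - j + (j - k) ≡ i - k
    telescope = solve-∀

  ≡-mod-sym : ∀ {d i j} → i ≡ j mod d → j ≡ i mod d
  ≡-mod-sym {i = i} {j} (≡-mod d∣i-j) = ≡-mod (subst (_ ∣_) (negate i j) (∣m⇒∣-m d∣i-j))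
    where
    negate : ∀ i j → - (i - j) ≡ j - i
    negate = solve-∀

  ≡-mod-reflexive : ∀ {d i j} → i ≡ j → i ≡ j mod d
  ≡-mod-reflexive {i = i} refl = ≡-mod (divides 0ℤ (ℤ.+-inverseʳ i))

  ≡-mod-*ʳ : ∀ {d i j} x → i ≡ j mod d → i * x ≡ j * x mod d
  ≡-mod-*ʳ {i = i} {j} x (≡-mod d∣i-j) = ≡-mod (subst (_ ∣_) (distrib i j x) (∣m⇒∣m*n x d∣i-j))
    where
    distrib : ∀ i j x → (i - j) * x ≡ i * x - j * x
    distrib = solve-∀

  ≡-%ℕ-mod : ∀ d .{{_ : ℕ.NonZero d}} i → i ≡ + (i %ℕ d) mod d
  ≡-%ℕ-mod d i = ≡-mod (divides (i /ℕ d) (begin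
    i - + r                        ≡⟨ cong (_- + r) (a≡a%ℕn+[a/ℕn]*n i d) ⟩
    + r + i /ℕ d * + d - + r       ≡⟨ cancel (+ r) (i /ℕ d * + d) ⟩
    i /ℕ d * + d                   ∎))
    where
    r = i %ℕ d
    cancel : ∀ r x → r + x - r ≡ x
    cancel = solve-∀

  ∣<⇒≡0 : ∀ {d x} .{{_ : ℕ.NonZero d}} → d ℕ.∣ x → x ℕ.< d → x ≡ 0
  ∣<⇒≡0 {x = zero}  _   _   = refl
  ∣<⇒≡0 {x = suc _} d∣x x<d = contradiction d∣x (ℕ.>⇒∤ x<d)

  ≡-mod-unique : ∀ {d r s} .{{_ : ℕ.NonZero d}} → r ℕ.< d → s ℕ.< d → + r ≡ + s mod d → r ≡ s
  ≡-mod-unique {d} {r} {s} r<d s<d (≡-mod d∣r-s) =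
    ℤ.+-injective (ℤ.i-j≡0⇒i≡j (+ r) (+ s) (ℤ.∣i∣≡0⇒i≡0 (∣<⇒≡0 (∣⇒∣ᵤ d∣r-s) ∣r-s∣<d)))
    where
    ∣r-s∣<d : ∣ + r - + s ∣ ℕ.< d
    ∣r-s∣<d = ℕ.≤-<-trans (subst (ℕ._≤ r ℕ.⊔ s) (cong ∣_∣ (sym (ℤ.m-n≡m⊖n r s))) (ℤ.∣m⊝n∣≤m⊔n r s))
                          (ℕ.⊔-lub r<d s<d)

  %ℕ-cong : ∀ d .{{_ : ℕ.NonZero d}} {i j} → i ≡ j mod d → i %ℕ d ≡ j %ℕ d
  %ℕ-cong d {i} {j} i≡j = ≡-mod-unique (n%ℕd<d i d) (n%ℕd<d j d)
    (≡-mod-trans (≡-mod-trans (≡-mod-sym (≡-%ℕ-mod d i)) i≡j) (≡-%ℕ-mod d j))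

  sinCoeff-zero-suc : ∀ n → sinCoeff 0 (suc n) ≡ 0ℤ
  sinCoeff-zero-suc zero    = refl
  sinCoeff-zero-suc (suc n) = refl

  5∣sinCoeff : ∀ j n → + 5 ∣ sinCoeff (3 ℕ.+ j) n
  5∣sinCoeff j       zero          = divides 0ℤ refl
  5∣sinCoeff j       (suc zero)    = divides 0ℤ refl
  5∣sinCoeff zero    (suc (suc n)) =
    ∣m∣n⇒∣m-n (∣m⇒∣m*n (sinCoeff 2 n) (divides (+ 6) refl)) (∣n⇒∣m*n (+ 9) (5∣sinCoeff 0 n))
  5∣sinCoeff (suc j) (suc (suc n)) =
    ∣m∣n⇒∣m-n (∣n⇒∣m*n (+ (2 ℕ.* (4 ℕ.+ j) ℕ.* (2 ℕ.* (3 ℕ.+ j) ℕ.+ 1))) (5∣sinCoeff j n))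
              (∣n⇒∣m*n (+ ((4 ℕ.+ j) ℕ.* (4 ℕ.+ j))) (5∣sinCoeff (suc j) n))

  sinCoeff-one-even : ∀ j → sinCoeff 1 (2 ℕ.* suc j) ≡ -1ℤ ^ suc (suc j) * + 2
  sinCoeff-one-even zero    = refl
  sinCoeff-one-even (suc j) = begin
    sinCoeff 1 (2 ℕ.* suc (suc j))             ≡⟨ cong (sinCoeff 1) (index j) ⟩
    sinCoeff 1 (suc (suc (2 ℕ.* suc j)))       ≡⟨ recurrence (2 ℕ.* suc j) (sinCoeff-zero-suc (ℕ.pred (2 ℕ.* suc j))) ⟩
    - sinCoeff 1 (2 ℕ.* suc j)                 ≡⟨ cong -_ (sinCoeff-one-even j) ⟩
    - (-1ℤ ^ suc (suc j) * + 2)                ≡⟨ negate (-1ℤ ^ suc (suc j)) ⟩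
    -1ℤ ^ suc (suc (suc j)) * + 2              ∎
    where
    index : ∀ j → 2 ℕ.* suc (suc j) ≡ suc (suc (2 ℕ.* suc j))
    index = NatSolver.solve-∀
    recurrence : ∀ n → sinCoeff 0 n ≡ 0ℤ → sinCoeff 1 (suc (suc n)) ≡ - sinCoeff 1 n
    recurrence n eq = trans (cong (λ z → + 2 * z - + 1 * sinCoeff 1 n) eq) (simplify (sinCoeff 1 n))
      where
      simplify : ∀ x → + 2 * 0ℤ - + 1 * x ≡ - x
      simplify = solve-∀
    negate : ∀ x → - (x * + 2) ≡ -1ℤ * x * + 2
    negate = solve-∀

  sumUpToℤ≡first-two : ∀ {d} f → (∀ i → + d ∣ f (2 ℕ.+ i)) → ∀ n → sumUpToℤ (suc n) f ≡ f 0 + f 1 mod d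
  sumUpToℤ≡first-two f d∣f[2+i] zero    = ≡-mod-reflexive refl
  sumUpToℤ≡first-two f d∣f[2+i] (suc n) with sumUpToℤ≡first-two f d∣f[2+i] n
  ... | ≡-mod d∣s-f₀-f₁ = ≡-mod (subst (_ ∣_) (rearrange (sumUpToℤ (suc n) f) (f 0 + f 1) (f (2 ℕ.+ n)))
                                        (∣m∣n⇒∣m+n d∣s-f₀-f₁ (d∣f[2+i] n)))
    where
    rearrange : ∀ s a x → s - a + x ≡ s + x - a
    rearrange = solve-∀

  polyBernoulli2ℤ-even : ∀ j k → polyBernoulli2ℤ (2 ℕ.* suc j) (suc k) ≡ + (3 ℕ.^ suc k) * (-1ℤ ^ suc (suc j) * + 2) mod 5
  polyBernoulli2ℤ-even j k = ≡-mod-trans (sumUpToℤ≡first-two term 5∣term[2+i] (ℕ.pred n)) (≡-mod-reflexive (begin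
    term 0 + term 1
      ≡⟨ cong₂ (λ x y → + (1 ℕ.^ suc k) * x + + (3 ℕ.^ suc k) * y) (sinCoeff-zero-suc (ℕ.pred n)) (sinCoeff-one-even j) ⟩
    + (1 ℕ.^ suc k) * 0ℤ + r
      ≡⟨ cong (_+ r) (ℤ.*-zeroʳ (+ (1 ℕ.^ suc k))) ⟩
    0ℤ + r
      ≡⟨ ℤ.+-identityˡ r ⟩
    r
      ∎))
    where
    r = + (3 ℕ.^ suc k) * (-1ℤ ^ suc (suc j) * + 2)
    n = 2 ℕ.* suc j
    term : ℕ → ℤ
    term m = + ((2 ℕ.* m ℕ.+ 1) ℕ.^ suc k) * sinCoeff m n
    5∣term[2+i] : ∀ i → + 5 ∣ term (2 ℕ.+ i)
    5∣term[2+i] zero    = ∣m⇒∣m*n (sinCoeff 2 n) (divides (+ (5 ℕ.^ k)) (trans (ℤ.pos-* 5 (5 ℕ.^ k)) (ℤ.*-comm (+ 5) (+ (5 ℕ.^ k)))))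
    5∣term[2+i] (suc i) = ∣n⇒∣m*n (+ ((2 ℕ.* (3 ℕ.+ i) ℕ.+ 1) ℕ.^ suc k)) (5∣sinCoeff i n)

  -1ℤ^n≡-1ℤ^[n%2] : ∀ n → -1ℤ ^ n ≡ -1ℤ ^ (n ℕ.% 2)
  -1ℤ^n≡-1ℤ^[n%2] 0 = refl
  -1ℤ^n≡-1ℤ^[n%2] 1 = refl
  -1ℤ^n≡-1ℤ^[n%2] (suc (suc n)) = begin
    -1ℤ * (-1ℤ * -1ℤ ^ n)        ≡⟨ cancel (-1ℤ ^ n) ⟩
    -1ℤ ^ n                      ≡⟨ -1ℤ^n≡-1ℤ^[n%2] n ⟩
    -1ℤ ^ (n ℕ.% 2)              ≡⟨ cong (-1ℤ ^_) (ℕ.[m+n]%n≡m%n n 2) ⟨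
    -1ℤ ^ ((n ℕ.+ 2) ℕ.% 2)      ≡⟨ cong (λ m → -1ℤ ^ (m ℕ.% 2)) (ℕ.+-comm n 2) ⟩
    -1ℤ ^ (suc (suc n) ℕ.% 2)    ∎
    where
    cancel : ∀ x → -1ℤ * (-1ℤ * x) ≡ x
    cancel = solve-∀

  3^k≡3^[k%4] : ∀ k → + (3 ℕ.^ k) ≡ + (3 ℕ.^ (k ℕ.% 4)) mod 5
  3^k≡3^[k%4] 0 = ≡-mod-reflexive refl
  3^k≡3^[k%4] 1 = ≡-mod-reflexive refl
  3^k≡3^[k%4] 2 = ≡-mod-reflexive refl
  3^k≡3^[k%4] 3 = ≡-mod-reflexive refl
  3^k≡3^[k%4] (suc (suc (suc (suc k)))) =
    ≡-mod-trans 3^[4+k]≡3^k (subst (λ r → + (3 ℕ.^ k) ≡ + (3 ℕ.^ r) mod 5) [4+k]%4≡k%4 (3^k≡3^[k%4] k))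
    where
    [4+k]%4≡k%4 : k ℕ.% 4 ≡ (4 ℕ.+ k) ℕ.% 4
    [4+k]%4≡k%4 = trans (sym (ℕ.[m+n]%n≡m%n k 4)) (cong (ℕ._% 4) (ℕ.+-comm k 4))
    81x-x≡16x*5 : ∀ x → + 81 * x - x ≡ + 16 * x * + 5
    81x-x≡16x*5 = solve-∀
    3^[4+k]≡3^k : + (3 ℕ.^ (4 ℕ.+ k)) ≡ + (3 ℕ.^ k) mod 5
    3^[4+k]≡3^k = ≡-mod (divides (+ 16 * + (3 ℕ.^ k)) (begin
      + (3 ℕ.^ (4 ℕ.+ k)) - + (3 ℕ.^ k)       ≡⟨ cong (λ x → + x - + (3 ℕ.^ k)) (ℕ.^-distribˡ-+-* 3 4 k) ⟩
      + (81 ℕ.* 3 ℕ.^ k) - + (3 ℕ.^ k)        ≡⟨ cong (_- + (3 ℕ.^ k)) (ℤ.pos-* 81 (3 ℕ.^ k)) ⟩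
      + 81 * + (3 ℕ.^ k) - + (3 ℕ.^ k)        ≡⟨ 81x-x≡16x*5 (+ (3 ℕ.^ k)) ⟩
      + 16 * + (3 ℕ.^ k) * + 5                ∎))

  residue-table : ∀ a b → a ℕ.< 2 → b ℕ.< 4 → (+ (3 ℕ.^ b) * (-1ℤ ^ suc a * + 2)) %ℕ 5 ≡ residue a b
  residue-table 0 0 _ _ = refl
  residue-table 0 1 _ _ = refl
  residue-table 0 2 _ _ = refl
  residue-table 0 3 _ _ = refl
  residue-table 1 0 _ _ = refl
  residue-table 1 1 _ _ = refl
  residue-table 1 2 _ _ = refl
  residue-table 1 3 _ _ = refl
  residue-table (suc (suc _)) _ (ℕ.s≤s (ℕ.s≤s ())) _
  residue-table 0 (suc (suc (suc (suc _)))) _ (ℕ.s≤s (ℕ.s≤s (ℕ.s≤s (ℕ.s≤s ()))))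
  residue-table 1 (suc (suc (suc (suc _)))) _ (ℕ.s≤s (ℕ.s≤s (ℕ.s≤s (ℕ.s≤s ()))))

  polyBernoulli2ℤ-even-%ℕ5 : ∀ j k → polyBernoulli2ℤ (2 ℕ.* suc j) (suc k) %ℕ 5 ≡ residue (suc j ℕ.% 2) (suc k ℕ.% 4)
  polyBernoulli2ℤ-even-%ℕ5 j k = begin
    polyBernoulli2ℤ (2 ℕ.* n) (suc k) %ℕ 5
      ≡⟨ %ℕ-cong 5 (≡-mod-trans (polyBernoulli2ℤ-even j k) (≡-mod-*ʳ (-1ℤ ^ suc n * + 2) (3^k≡3^[k%4] (suc k)))) ⟩
    (+ (3 ℕ.^ (suc k ℕ.% 4)) * (-1ℤ ^ suc n * + 2)) %ℕ 5
      ≡⟨ cong (λ s → (+ (3 ℕ.^ (suc k ℕ.% 4)) * (-1ℤ * s * + 2)) %ℕ 5) (-1ℤ^n≡-1ℤ^[n%2] n) ⟩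
    (+ (3 ℕ.^ (suc k ℕ.% 4)) * (-1ℤ ^ suc (n ℕ.% 2) * + 2)) %ℕ 5
      ≡⟨ residue-table (n ℕ.% 2) (suc k ℕ.% 4) (ℕ.m%n<n n 2) (ℕ.m%n<n (suc k) 4) ⟩
    residue (n ℕ.% 2) (suc k ℕ.% 4)
      ∎
    where
    n = suc j

open import Data.Nat using (ℕ; _≥_; _*_; _%_)
open import Data.Integer using (ℤ; _%ℕ_)
open import Data.Rational using (_/_)
open import Data.Product using (∃; _×_)

theorem12 : (n k : ℕ) → n ≥ 1 → k ≥ 1 →
    ∃ λ (z : ℤ) → polyBernoulli2 (2 * n) k ≡ z / 1 × z %ℕ 5 ≡ residue (n % 2) (k % 4)
theorem12 zero    _       ()  _
theorem12 (suc j) zero    _   ()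
theorem12 (suc j) (suc k) _   _ =
  polyBernoulli2ℤ (2 * suc j) (suc k) , polyBernoulli2≡fromℤ (2 * suc j) (suc k) , polyBernoulli2ℤ-even-%ℕ5 j k
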